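{- Let $a,b\geq 1$ and let $K_{a,b}$ be the complete bipartite graph with sides $A$ of size $a$ and $B$ of size $b$. Then $$\widetilde{T}_{K_{a,b}}(2,0)\widetilde{T}_{K_{a,b}}(0,2)\geq \widetilde{T}_{K_{a,b}}(1,1)^2.$$
   Context: A bipartite graph $H=(A,B,E)$ comes with designated sides $A,B$. For $m=|V(H)|$ and a permutation $\pi$ of $V(H)$ (a bijection to $[m]$), a vertex $i\in A$ is internally active if $\pi(i)>\pi(j)$ for all neighbours $j$ of $i$, and $j\in B$ is externally active if $\pi(j)>\pi(i)$ for all neighbours $i$ of $j$; $\mathrm{ia}(\pi),\mathrm{ea}(\pi)$ are their numbers, and $\widetilde{T}_H(x,y)=\frac{1}{m!}\sum_{\pi}x^{\mathrm{ia}(\pi)}y^{\mathrm{ea}(\pi)}$. Note $\widetilde{T}_H(1,1)=1$. -}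

module Defs where

open import Data.Bool using (Bool; true)
open import Data.Nat using (ℕ; zero; suc; _+_; _*_; _^_; _<_; _!)
open import Data.Nat.Properties using (_!≢0)
open import Data.Fin using (Fin; _↑ˡ_; _↑ʳ_; toℕ)
import Data.Fin.Properties as FinP
open import Data.Vec using (Vec; []; _∷_; lookup)
open import Data.List using (List; []; _∷_; concatMap; map; filter; length)
open import Data.Nat.ListAction using (sum)
open import Data.List.Base using (allFin)
open import Data.Integer using (+_)
open import Data.Rational using (ℚ; _/_)
open import Relation.Binary.PropositionalEquality using (_≡_)
open import Relation.Nullary.Decidable using (Dec; _→-dec_)
open import Relation.Unary using (Decidable)

record BipGraph : Set where
  field
    a b : ℕ
    adj : Fin a → Fin b → Bool

open BipGraph public

nV : BipGraph → ℕ
nV H = a H + b H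

vA : (H : BipGraph) → Fin (a H) → Fin (nV H)
vA H i = i ↑ˡ b H

vB : (H : BipGraph) → Fin (b H) → Fin (nV H)
vB H j = a H ↑ʳ j

-- A labelling π : V(H) → [m], represented by Fin m → Fin m (values 0..m-1,
-- order-equivalent to [m]).
Labelling : BipGraph → Set
Labelling H = Fin (nV H) → Fin (nV H)

IntActive : (H : BipGraph) → Labelling H → Fin (a H) → Set
IntActive H π i = (j : Fin (b H)) → adj H i j ≡ true → toℕ (π (vB H j)) < toℕ (π (vA H i))

ExtActive : (H : BipGraph) → Labelling H → Fin (b H) → Set
ExtActive H π j = (i : Fin (a H)) → adj H i j ≡ true → toℕ (π (vA H i)) < toℕ (π (vB H j))

intActive? : (H : BipGraph) (π : Labelling H) → Decidable (IntActive H π)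
intActive? H π i = FinP.all? λ j → (adj H i j Data.Bool.≟ true) →-dec (toℕ (π (vB H j)) Data.Nat.<? toℕ (π (vA H i)))
  where import Data.Bool; import Data.Nat

extActive? : (H : BipGraph) (π : Labelling H) → Decidable (ExtActive H π)
extActive? H π j = FinP.all? λ i → (adj H i j Data.Bool.≟ true) →-dec (toℕ (π (vA H i)) Data.Nat.<? toℕ (π (vB H j)))
  where import Data.Bool; import Data.Nat

ia : (H : BipGraph) → Labelling H → ℕ
ia H π = length (filter (intActive? H π) (allFin (a H)))

ea : (H : BipGraph) → Labelling H → ℕ
ea H π = length (filter (extActive? H π) (allFin (b H)))

allVecs : (k n : ℕ) → List (Vec (Fin n) k)
allVecs zero n = [] ∷ []
allVecs (suc k) n = concatMap (λ v → map (λ x → x ∷ v) (allFin n)) (allVecs k n)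

Injective : {n : ℕ} → (Fin n → Fin n) → Set
Injective {n} f = (i j : Fin n) → f i ≡ f j → i ≡ j

injective? : {n : ℕ} → Decidable (Injective {n})
injective? f = FinP.all? λ i → FinP.all? λ j → (f i FinP.≟ f j) →-dec (i FinP.≟ j)

allPerms : (n : ℕ) → List (Fin n → Fin n)
allPerms n = filter injective? (map lookup (allVecs n n))

-- Σ_π x^{ia(π)} y^{ea(π)}   (with 0^0 = 1)
activitySum : BipGraph → ℕ → ℕ → ℕ
activitySum H x y = sum (map (λ π → x ^ ia H π * y ^ ea H π) (allPerms (nV H)))

Ttilde : BipGraph → ℕ → ℕ → ℚ
Ttilde H x y = _/_ (+ activitySum H x y) (nV H !) {{nV H !≢0}}

K : ℕ → ℕ → BipGraph
K a b = record { a = a ; b = b ; adj = λ _ _ → true }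

module Submission where

-- A vertex i ∈ A is internally
-- active as soon as it carries the largest label on {i} ∪ B, and transposing
-- labels shows that each of these b + 1 vertices is the largest equally often;
-- hence Σ_π ia(π) ≥ a·m!/(b+1), and likewise Σ_π ea(π) ≥ b·m!/(a+1).  In K_{a,b}
-- no labelling has an internally and an externally active vertex at the same
-- time, so 2^ia(π)·0^ea(π) ≥ 2·ia(π) and T̃(2,0) ≥ 2a/(b+1), T̃(0,2) ≥ 2b/(a+1).
-- The product 4ab/((a+1)(b+1)) is at least 1 when a, b ≥ 1.

open import Defs
open import Data.Bool using (true; false)
open import Data.Empty using (⊥-elim)
open import Data.Fin using (Fin; toℕ)
import Data.Fin.Properties as Fin
open import Data.Fin.Permutation using (Permutation′; _⟨$⟩ʳ_; _⟨$⟩ˡ_; flip; inverseˡ; inverseʳ; transpose)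
import Data.Fin.Permutation.Components as PC
import Data.Integer as ℤ
import Data.Integer.Properties as ℤ
open import Data.List using (List; []; _∷_; _++_; map; filter; length; concatMap; cartesianProductWith; allFin)
open import Data.List.Extrema.Nat using (argmax; argmax-all; f[⊥]≤f[argmax]; f[xs]≤f[argmax])
import Data.List.Properties as List
open import Data.List.Membership.Propositional using (_∈_)
open import Data.List.Membership.Propositional.Properties
  using (∈-map⁺; ∈-map⁻; ∈-filter⁺; ∈-filter⁻; ∈-allFin; ∈-cartesianProductWith⁺)
open import Data.List.Membership.Propositional.Properties.WithK using (unique∧set⇒bag)
open import Data.List.Relation.Binary.BagAndSetEquality using (∼bag⇒↭)
open import Data.List.Relation.Binary.Permutation.Propositional using (_↭_)
import Data.List.Relation.Binary.Permutation.Propositional.Properties as ↭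
open import Data.List.Relation.Unary.All as All using (All; _∷_)
open import Data.List.Relation.Unary.Any using (here; there)
import Data.List.Relation.Unary.AllPairs as AllPairs
open import Data.List.Relation.Unary.Unique.Propositional using (Unique)
import Data.List.Relation.Unary.Unique.Propositional.Properties as Unique
open import Data.Nat
open import Data.Nat.ListAction using (sum)
open import Data.Nat.ListAction.Properties using (sum-↭)
open import Data.Nat.Properties
open import Algebra.Properties.CommutativeSemigroup +-commutativeSemigroup using (interchange)
open import Data.Nat.Tactic.RingSolver using (solve-∀)
open import Data.Product using (∃; _×_; _,_; proj₂)
import Data.Rational as ℚ
import Data.Rational.Properties as ℚ
import Data.Rational.Unnormalised as ℚᵘ
import Data.Rational.Unnormalised.Properties as ℚᵘ
open import Data.Sum using (_⊎_; inj₁; inj₂; swap)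
open import Data.Vec using (Vec; lookup; tabulate) renaming ([] to []ᵥ; _∷_ to _∷ᵥ_)
import Data.Vec.Properties as Vec
open import Function using (_∘_; id; mk⇔)
open import Relation.Binary.PropositionalEquality
open import Relation.Nullary using (Dec; yes; no; does)
open import Relation.Nullary.Decidable using (dec-true)
open import Relation.Unary using (Decidable)

module _ {A : Set} where

  sum-map-+ : (f g : A → ℕ) (xs : List A) →
              sum (map (λ x → f x + g x) xs) ≡ sum (map f xs) + sum (map g xs)
  sum-map-+ f g []       = refl
  sum-map-+ f g (x ∷ xs) = trans (cong ((f x + g x) +_) (sum-map-+ f g xs)) (interchange (f x) (g x) _ _)

  sum-map-const : (c : ℕ) (xs : List A) → sum (map (λ _ → c) xs) ≡ length xs * c
  sum-map-const c []       = refl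
  sum-map-const c (x ∷ xs) = cong (c +_) (sum-map-const c xs)

  sum-map-*ˡ : (c : ℕ) (f : A → ℕ) (xs : List A) → sum (map (λ x → c * f x) xs) ≡ c * sum (map f xs)
  sum-map-*ˡ c f []       = sym (*-zeroʳ c)
  sum-map-*ˡ c f (x ∷ xs) = trans (cong (c * f x +_) (sum-map-*ˡ c f xs)) (sym (*-distribˡ-+ c (f x) _))

  sum-map-mono-≤ : {f g : A → ℕ} (xs : List A) → (∀ {x} → x ∈ xs → f x ≤ g x) →
                   sum (map f xs) ≤ sum (map g xs)
  sum-map-mono-≤ []       f≤g = z≤n
  sum-map-mono-≤ (x ∷ xs) f≤g = +-mono-≤ (f≤g (here refl)) (sum-map-mono-≤ xs (f≤g ∘ there))

  sum-map-*-mono-≤ : {f g : A → ℕ} (c : ℕ) (xs : List A) → (∀ {x} → x ∈ xs → c * f x ≤ g x) →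
                    c * sum (map f xs) ≤ sum (map g xs)
  sum-map-*-mono-≤ {f} c xs cf≤g = ≤-trans (≤-reflexive (sym (sum-map-*ˡ c f xs))) (sum-map-mono-≤ xs cf≤g)

  ∈⇒≤sum-map : (f : A → ℕ) {x : A} {xs : List A} → x ∈ xs → f x ≤ sum (map f xs)
  ∈⇒≤sum-map f {xs = y ∷ ys} (here refl) = m≤m+n (f y) _
  ∈⇒≤sum-map f {xs = y ∷ ys} (there x∈)  = ≤-trans (∈⇒≤sum-map f x∈) (m≤n+m _ (f y))

sum-map-swap : {A B : Set} (f : A → B → ℕ) (xs : List A) (ys : List B) →
               sum (map (λ x → sum (map (f x) ys)) xs) ≡ sum (map (λ y → sum (map (λ x → f x y) xs)) ys)
sum-map-swap f []       ys = sym (trans (sum-map-const 0 ys) (*-zeroʳ (length ys)))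
sum-map-swap f (x ∷ xs) ys =
  trans (cong (sum (map (f x) ys) +_) (sum-map-swap f xs ys))
        (sym (sum-map-+ (f x) (λ y → sum (map (λ x′ → f x′ y) xs)) ys))

indicator : {P : Set} → Dec P → ℕ
indicator (yes _) = 1
indicator (no _)  = 0

indicator-mono : {P Q : Set} → (P → Q) → (p : Dec P) (q : Dec Q) → indicator p ≤ indicator q
indicator-mono P⇒Q (yes p) (yes q) = ≤-refl
indicator-mono P⇒Q (yes p) (no ¬q) = ⊥-elim (¬q (P⇒Q p))
indicator-mono P⇒Q (no _)  q       = z≤n

1≤indicator : {P : Set} (p? : Dec P) → P → 1 ≤ indicator p?
1≤indicator p? p = indicator-mono (λ _ → p) (yes p) p?

module _ {A : Set} {P : A → Set} (P? : Decidable P) where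

  length-filter≡sum-indicator : (xs : List A) → length (filter P? xs) ≡ sum (map (indicator ∘ P?) xs)
  length-filter≡sum-indicator []       = refl
  length-filter≡sum-indicator (x ∷ xs) with P? x
  ... | yes _ = cong suc (length-filter≡sum-indicator xs)
  ... | no _  = length-filter≡sum-indicator xs

  length-filter≡suc⇒∃ : (xs : List A) {k : ℕ} → length (filter P? xs) ≡ suc k → ∃ P
  length-filter≡suc⇒∃ (x ∷ xs) eq with P? x
  ... | yes px = x , px
  ... | no _   = length-filter≡suc⇒∃ xs eq

filter-map : {A B : Set} {P : B → Set} (P? : Decidable P) (f : A → B) (xs : List A) →
             filter P? (map f xs) ≡ map f (filter (P? ∘ f) xs)
filter-map P? f []       = refl
filter-map P? f (x ∷ xs) with does (P? (f x))
... | true  = cong (f x ∷_) (filter-map P? f xs)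
... | false = filter-map P? f xs

concatMap-map≡cartesianProductWith : {A B C : Set} (f : A → B → C) (xs : List A) (ys : List B) →
                                     concatMap (λ x → map (f x) ys) xs ≡ cartesianProductWith f xs ys
concatMap-map≡cartesianProductWith f []       ys = refl
concatMap-map≡cartesianProductWith f (x ∷ xs) ys =
  cong (map (f x) ys ++_) (concatMap-map≡cartesianProductWith f xs ys)

allVecs-unique : (k n : ℕ) → Unique (allVecs k n)
allVecs-unique zero    n = All.[] AllPairs.∷ AllPairs.[]
allVecs-unique (suc k) n
  rewrite concatMap-map≡cartesianProductWith (λ v x → x ∷ᵥ v) (allVecs k n) (allFin n) =
  Unique.cartesianProductWith⁺ _ ∷-injective (allVecs-unique k n) (Unique.allFin⁺ n)
  where
  ∷-injective : ∀ {v w : Vec (Fin n) k} {x y} → x ∷ᵥ v ≡ y ∷ᵥ w → v ≡ w × x ≡ y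
  ∷-injective refl = refl , refl

∈-allVecs : {k n : ℕ} (v : Vec (Fin n) k) → v ∈ allVecs k n
∈-allVecs []ᵥ = here refl
∈-allVecs {suc k} {n} (x ∷ᵥ v)
  rewrite concatMap-map≡cartesianProductWith (λ v x → x ∷ᵥ v) (allVecs k n) (allFin n) =
  ∈-cartesianProductWith⁺ _ (∈-allVecs v) (∈-allFin x)

-- Permutations are enumerated as vectors rather than functions: vectors have
-- decidable equality, so the enumeration can be shown to be duplicate-free.

injectiveVec? : {n : ℕ} → Decidable (λ (v : Vec (Fin n) n) → Injective (lookup v))
injectiveVec? = injective? ∘ lookup

permVecs : (n : ℕ) → List (Vec (Fin n) n)
permVecs n = filter injectiveVec? (allVecs n n)

module _ {n : ℕ} where

  ∈-permVecs⁺ : {v : Vec (Fin n) n} → Injective (lookup v) → v ∈ permVecs n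
  ∈-permVecs⁺ {v} inj = ∈-filter⁺ injectiveVec? (∈-allVecs v) inj

  ∈-permVecs⁻ : {v : Vec (Fin n) n} → v ∈ permVecs n → Injective (lookup v)
  ∈-permVecs⁻ v∈ = proj₂ (∈-filter⁻ injectiveVec? {xs = allVecs n n} v∈)

  permVecs-unique : Unique (permVecs n)
  permVecs-unique = Unique.filter⁺ injectiveVec? (allVecs-unique n n)

  sum-allPerms : (f : (Fin n → Fin n) → ℕ) → sum (map f (allPerms n)) ≡ sum (map (f ∘ lookup) (permVecs n))
  sum-allPerms f =
    trans (cong (sum ∘ map f) (filter-map injective? lookup (allVecs n n)))
          (cong sum (sym (List.map-∘ (permVecs n))))

  precompose : Permutation′ n → Vec (Fin n) n → Vec (Fin n) n
  precompose σ v = tabulate (λ k → lookup v (σ ⟨$⟩ʳ k))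

  lookup-precompose : (σ : Permutation′ n) (v : Vec (Fin n) n) (k : Fin n) →
                      lookup (precompose σ v) k ≡ lookup v (σ ⟨$⟩ʳ k)
  lookup-precompose σ v = Vec.lookup∘tabulate _

  precompose-cancel : (σ τ : Permutation′ n) → (∀ k → σ ⟨$⟩ʳ (τ ⟨$⟩ʳ k) ≡ k) →
                      (v : Vec (Fin n) n) → precompose τ (precompose σ v) ≡ v
  precompose-cancel σ τ στ≡id v =
    trans (Vec.tabulate-cong λ k → trans (lookup-precompose σ v (τ ⟨$⟩ʳ k)) (cong (lookup v) (στ≡id k)))
          (Vec.tabulate∘lookup v)

  precompose-injective : (σ : Permutation′ n) {v : Vec (Fin n) n} →
                         Injective (lookup v) → Injective (lookup (precompose σ v))
  precompose-injective σ {v} inj i j eq = begin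
    i                               ≡⟨ inverseˡ σ ⟨
    σ ⟨$⟩ˡ (σ ⟨$⟩ʳ i)               ≡⟨ cong (σ ⟨$⟩ˡ_) σi≡σj ⟩
    σ ⟨$⟩ˡ (σ ⟨$⟩ʳ j)               ≡⟨ inverseˡ σ ⟩
    j                               ∎
    where
    open ≡-Reasoning
    σi≡σj : σ ⟨$⟩ʳ i ≡ σ ⟨$⟩ʳ j
    σi≡σj = inj _ _ (trans (sym (lookup-precompose σ v i)) (trans eq (lookup-precompose σ v j)))

  map-precompose-permVecs↭ : (σ : Permutation′ n) → map (precompose σ) (permVecs n) ↭ permVecs n
  map-precompose-permVecs↭ σ =
    ∼bag⇒↭ (unique∧set⇒bag (Unique.map⁺ precompose-σ-injective permVecs-unique) permVecs-unique (mk⇔ to from))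
    where
    precompose-σ-injective : ∀ {v w} → precompose σ v ≡ precompose σ w → v ≡ w
    precompose-σ-injective {v} {w} eq =
      trans (sym (precompose-cancel σ (flip σ) (λ _ → inverseʳ σ) v))
            (trans (cong (precompose (flip σ)) eq) (precompose-cancel σ (flip σ) (λ _ → inverseʳ σ) w))
    to : ∀ {w} → w ∈ map (precompose σ) (permVecs n) → w ∈ permVecs n
    to w∈ with ∈-map⁻ (precompose σ) w∈
    ... | v , v∈ , refl = ∈-permVecs⁺ (precompose-injective σ {v} (∈-permVecs⁻ v∈))
    from : ∀ {w} → w ∈ permVecs n → w ∈ map (precompose σ) (permVecs n)
    from {w} w∈ = subst (_∈ map (precompose σ) (permVecs n))
      (precompose-cancel (flip σ) σ (λ _ → inverseˡ σ) w)
      (∈-map⁺ (precompose σ) (∈-permVecs⁺ {precompose (flip σ) w}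
        (precompose-injective (flip σ) {w} (∈-permVecs⁻ w∈))))

  sum-permVecs-precompose : (σ : Permutation′ n) (g : Vec (Fin n) n → ℕ) →
                            sum (map g (permVecs n)) ≡ sum (map (g ∘ precompose σ) (permVecs n))
  sum-permVecs-precompose σ g =
    trans (sym (sum-↭ (↭.map⁺ g (map-precompose-permVecs↭ σ)))) (cong sum (sym (List.map-∘ (permVecs n))))

transpose-matchˡ : {n : ℕ} (i j : Fin n) → PC.transpose i j i ≡ j
transpose-matchˡ i j rewrite dec-true (i Fin.≟ i) refl = refl

transpose-∈ : {n : ℕ} {i j k : Fin n} {xs : List (Fin n)} → i ∈ xs → j ∈ xs → k ∈ xs → PC.transpose i j k ∈ xs
transpose-∈ {i = i} {j} {k} i∈ j∈ k∈ with does (k Fin.≟ i)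
... | true = j∈
... | false with does (k Fin.≟ j)
...   | true  = i∈
...   | false = k∈

module _ {n : ℕ} where

  IsTop : (Fin n → Fin n) → List (Fin n) → Fin n → Set
  IsTop π L u = All (λ w → toℕ (π w) ≤ toℕ (π u)) L

  isTop? : (π : Fin n → Fin n) (L : List (Fin n)) → Decidable (IsTop π L)
  isTop? π L u = All.all? (λ w → toℕ (π w) ≤? toℕ (π u)) L

  isTop-cong : {π π′ : Fin n → Fin n} → (∀ k → π k ≡ π′ k) → ∀ {L u} → IsTop π L u → IsTop π′ L u
  isTop-cong {π} {π′} π≗π′ {u = u} = All.map λ {w} → subst₂ (λ p q → toℕ p ≤ toℕ q) (π≗π′ w) (π≗π′ u)

  isTop-∘ : (π : Fin n → Fin n) (σ : Permutation′ n) {L : List (Fin n)} {u : Fin n} →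
            (∀ {w} → w ∈ L → σ ⟨$⟩ˡ w ∈ L) → IsTop (π ∘ (σ ⟨$⟩ʳ_)) L u → IsTop π L (σ ⟨$⟩ʳ u)
  isTop-∘ π σ {u = u} σ⁻¹-closed top = All.tabulate λ w∈ →
    subst (λ z → toℕ (π z) ≤ toℕ (π (σ ⟨$⟩ʳ u))) (inverseʳ σ) (All.lookup top (σ⁻¹-closed w∈))

  ∃-isTop : (π : Fin n → Fin n) {L : List (Fin n)} {u : Fin n} → u ∈ L → ∃ λ t → t ∈ L × IsTop π L t
  ∃-isTop π {x ∷ xs} _ =
    argmax f x xs ,
    argmax-all f (here refl) (All.tabulate there) ,
    f[⊥]≤f[argmax] {f = f} x xs ∷ f[xs]≤f[argmax] {f = f} x xs
    where
    f : Fin n → ℕ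
    f = toℕ ∘ π

  module _ (L : List (Fin n)) where

    topCount : Fin n → ℕ
    topCount u = sum (map (λ v → indicator (isTop? (lookup v) L u)) (permVecs n))

    -- Precomposing with the transposition of u and u′ exchanges the labellings
    -- in which u is a top of L with those in which u′ is.
    topCount-mono : {u u′ : Fin n} → u ∈ L → u′ ∈ L → topCount u ≤ topCount u′
    topCount-mono {u} {u′} u∈ u′∈ = begin
      topCount u
        ≡⟨ sum-permVecs-precompose τ _ ⟩
      sum (map (λ v → indicator (isTop? (lookup (precompose τ v)) L u)) (permVecs n))
        ≤⟨ sum-map-mono-≤ (permVecs n) (λ {v} _ → indicator-mono (moved v) _ _) ⟩
      topCount u′ ∎
      where
      open ≤-Reasoning
      τ : Permutation′ n
      τ = transpose u u′
      moved : ∀ v → IsTop (lookup (precompose τ v)) L u → IsTop (lookup v) L u′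
      moved v top = subst (IsTop (lookup v) L) (transpose-matchˡ u u′)
        (isTop-∘ (lookup v) τ {u = u} (transpose-∈ u′∈ u∈) (isTop-cong (lookup-precompose τ v) top))

    length-permVecs≤length*topCount : {u : Fin n} → u ∈ L → length (permVecs n) ≤ length L * topCount u
    length-permVecs≤length*topCount {u} u∈ = begin
      length (permVecs n)                                  ≡⟨ trans (sum-map-const 1 (permVecs n)) (*-identityʳ _) ⟨
      sum (map (λ _ → 1) (permVecs n))                     ≤⟨ sum-map-mono-≤ (permVecs n) (λ {v} _ → someTop v) ⟩
      sum (map (λ v → sum (map (top v) L)) (permVecs n))   ≡⟨ sum-map-swap top (permVecs n) L ⟩
      sum (map topCount L)                                 ≤⟨ sum-map-mono-≤ L (λ w∈ → topCount-mono w∈ u∈) ⟩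
      sum (map (λ _ → topCount u) L)                       ≡⟨ sum-map-const _ L ⟩
      length L * topCount u                                ∎
      where
      open ≤-Reasoning
      top : Vec (Fin n) n → Fin n → ℕ
      top v w = indicator (isTop? (lookup v) L w)
      someTop : ∀ v → 1 ≤ sum (map (top v) L)
      someTop v with ∃-isTop (lookup v) u∈
      ... | t , t∈ , isTop = ≤-trans (1≤indicator _ isTop) (∈⇒≤sum-map (top v) t∈)

sum-count≥ : {n k ℓ : ℕ} {P : (Fin n → Fin n) → Fin k → Set} (P? : ∀ π → Decidable (P π))
             (u : Fin k → Fin n) (R : Fin k → List (Fin n)) → (∀ i → length (R i) ≡ ℓ) →
             (∀ π i → Injective π → IsTop π (u i ∷ R i) (u i) → P π i) →
             k * length (permVecs n) ≤ suc ℓ * sum (map (λ v → length (filter (P? (lookup v)) (allFin k))) (permVecs n))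
sum-count≥ {n} {k} {ℓ} P? u R |R|≡ℓ top⇒P = begin
  k * c
    ≡⟨ trans (sum-map-const c (allFin k)) (cong (_* c) (List.length-tabulate {n = k} id)) ⟨
  sum (map (λ _ → c) (allFin k))
    ≤⟨ sum-map-mono-≤ (allFin k) (λ {i} _ → c≤ℓ+1*X i) ⟩
  sum (map (λ i → suc ℓ * X i) (allFin k))
    ≡⟨ sum-map-*ˡ (suc ℓ) X (allFin k) ⟩
  suc ℓ * sum (map X (allFin k))
    ≡⟨ cong (suc ℓ *_) (sum-map-swap (λ i v → indicator (P? (lookup v) i)) (allFin k) (permVecs n)) ⟩
  suc ℓ * sum (map (λ v → sum (map (indicator ∘ P? (lookup v)) (allFin k))) (permVecs n))
    ≡⟨ cong (λ s → suc ℓ * sum s) (List.map-cong count≡ (permVecs n)) ⟨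
  suc ℓ * sum (map (λ v → length (filter (P? (lookup v)) (allFin k))) (permVecs n)) ∎
  where
  open ≤-Reasoning
  c : ℕ
  c = length (permVecs n)
  X : Fin k → ℕ
  X i = sum (map (λ v → indicator (P? (lookup v) i)) (permVecs n))
  count≡ : ∀ v → length (filter (P? (lookup v)) (allFin k)) ≡ sum (map (indicator ∘ P? (lookup v)) (allFin k))
  count≡ v = length-filter≡sum-indicator (P? (lookup v)) (allFin k)
  c≤ℓ+1*X : ∀ i → c ≤ suc ℓ * X i
  c≤ℓ+1*X i = begin
    c                                               ≤⟨ length-permVecs≤length*topCount (u i ∷ R i) (here refl) ⟩
    suc (length (R i)) * topCount (u i ∷ R i) (u i) ≡⟨ cong (λ l → suc l * _) (|R|≡ℓ i) ⟩
    suc ℓ * topCount (u i ∷ R i) (u i)              ≤⟨ *-monoʳ-≤ (suc ℓ) (sum-map-mono-≤ (permVecs n) top≤P) ⟩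
    suc ℓ * X i                                     ∎
    where
    top≤P : ∀ {v} → v ∈ permVecs n → indicator (isTop? (lookup v) (u i ∷ R i) (u i)) ≤ indicator (P? (lookup v) i)
    top≤P v∈ = indicator-mono (top⇒P _ i (∈-permVecs⁻ v∈)) _ _

module _ (H : BipGraph) where

  vA≢vB : (i : Fin (a H)) (j : Fin (b H)) → vA H i ≢ vB H j
  vA≢vB i j eq = <⇒≢ (≤-trans (Fin.toℕ<n i) (m≤m+n (a H) (toℕ j)))
    (trans (sym (Fin.toℕ-↑ˡ i (b H))) (trans (cong toℕ eq) (Fin.toℕ-↑ʳ (a H) j)))

  top⇒intActive : (π : Labelling H) (i : Fin (a H)) → Injective π →
                  IsTop π (vA H i ∷ map (vB H) (allFin (b H))) (vA H i) → IntActive H π i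
  top⇒intActive π i inj (_ ∷ top) j _ = ≤∧≢⇒< (All.lookup top (∈-map⁺ (vB H) (∈-allFin j)))
    (λ eq → vA≢vB i j (sym (inj _ _ (Fin.toℕ-injective eq))))

  top⇒extActive : (π : Labelling H) (j : Fin (b H)) → Injective π →
                  IsTop π (vB H j ∷ map (vA H) (allFin (a H))) (vB H j) → ExtActive H π j
  top⇒extActive π j inj (_ ∷ top) i _ = ≤∧≢⇒< (All.lookup top (∈-map⁺ (vA H) (∈-allFin i)))
    (λ eq → vA≢vB i j (inj _ _ (Fin.toℕ-injective eq)))

  sum-ia≥ : a H * length (permVecs (nV H)) ≤ suc (b H) * sum (map (ia H ∘ lookup) (permVecs (nV H)))
  sum-ia≥ = sum-count≥ (intActive? H) (vA H) (λ _ → map (vB H) (allFin (b H)))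
    (λ _ → trans (List.length-map (vB H) (allFin (b H))) (List.length-tabulate {n = b H} id)) top⇒intActive

  sum-ea≥ : b H * length (permVecs (nV H)) ≤ suc (a H) * sum (map (ea H ∘ lookup) (permVecs (nV H)))
  sum-ea≥ = sum-count≥ (extActive? H) (vB H) (λ _ → map (vA H) (allFin (a H)))
    (λ _ → trans (List.length-map (vA H) (allFin (a H))) (List.length-tabulate {n = a H} id)) top⇒extActive

  activitySum-permVecs : (x y : ℕ) →
    activitySum H x y ≡ sum (map (λ v → x ^ ia H (lookup v) * y ^ ea H (lookup v)) (permVecs (nV H)))
  activitySum-permVecs x y = sum-allPerms (λ π → x ^ ia H π * y ^ ea H π)

  activitySum-1-1 : activitySum H 1 1 ≡ length (permVecs (nV H))
  activitySum-1-1 = begin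
    activitySum H 1 1                                        ≡⟨ activitySum-permVecs 1 1 ⟩
    sum (map (λ v → 1 ^ ia H (lookup v) * 1 ^ ea H (lookup v)) (permVecs (nV H)))
      ≡⟨ cong sum (List.map-cong (λ v → cong₂ _*_ (^-zeroˡ (ia H (lookup v))) (^-zeroˡ (ea H (lookup v)))) (permVecs (nV H))) ⟩
    sum (map (λ _ → 1) (permVecs (nV H)))                    ≡⟨ sum-map-const 1 (permVecs (nV H)) ⟩
    length (permVecs (nV H)) * 1                             ≡⟨ *-identityʳ _ ⟩
    length (permVecs (nV H))                                 ∎
    where open ≡-Reasoning

ia≡0⊎ea≡0 : (a b : ℕ) (π : Labelling (K a b)) → ia (K a b) π ≡ 0 ⊎ ea (K a b) π ≡ 0
ia≡0⊎ea≡0 a b π with ia (K a b) π in ia≡ | ea (K a b) π in ea≡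
... | zero  | _     = inj₁ refl
... | suc _ | zero  = inj₂ refl
... | suc _ | suc _
  with length-filter≡suc⇒∃ (intActive? (K a b) π) (allFin a) ia≡
     | length-filter≡suc⇒∃ (extActive? (K a b) π) (allFin b) ea≡
... | i , i-active | j , j-active = ⊥-elim (<-asym (i-active j refl) (j-active i refl))

2*m≤2^m : (m : ℕ) → 2 * m ≤ 2 ^ m
2*m≤2^m zero          = z≤n
2*m≤2^m (suc zero)    = ≤-refl
2*m≤2^m (suc (suc m)) = begin
  2 * suc (suc m)         ≡⟨ *-suc 2 (suc m) ⟩
  2 + 2 * suc m           ≤⟨ +-mono-≤ (*-monoʳ-≤ 2 (m^n>0 2 m)) (2*m≤2^m (suc m)) ⟩
  2 ^ suc m + 2 ^ suc m   ≡⟨ cong (2 ^ suc m +_) (+-identityʳ _) ⟨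
  2 ^ suc (suc m)         ∎
  where open ≤-Reasoning

2*m≤2^m*0^n : (m n : ℕ) → m ≡ 0 ⊎ n ≡ 0 → 2 * m ≤ 2 ^ m * 0 ^ n
2*m≤2^m*0^n .0 n (inj₁ refl) = z≤n
2*m≤2^m*0^n m .0 (inj₂ refl) = ≤-trans (2*m≤2^m m) (≤-reflexive (sym (*-identityʳ _)))

module _ (a b : ℕ) where

  2*sum-ia≤activitySum-2-0 : 2 * sum (map (ia (K a b) ∘ lookup) (permVecs (a + b))) ≤ activitySum (K a b) 2 0
  2*sum-ia≤activitySum-2-0 =
    ≤-trans (sum-map-*-mono-≤ 2 (permVecs (a + b)) (λ {v} _ → 2*m≤2^m*0^n _ _ (ia≡0⊎ea≡0 a b (lookup v))))
            (≤-reflexive (sym (activitySum-permVecs (K a b) 2 0)))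

  2*sum-ea≤activitySum-0-2 : 2 * sum (map (ea (K a b) ∘ lookup) (permVecs (a + b))) ≤ activitySum (K a b) 0 2
  2*sum-ea≤activitySum-0-2 =
    ≤-trans (sum-map-*-mono-≤ 2 (permVecs (a + b)) λ {v} _ →
              ≤-trans (2*m≤2^m*0^n _ _ (swap (ia≡0⊎ea≡0 a b (lookup v))))
                      (≤-reflexive (*-comm (2 ^ ea (K a b) (lookup v)) (0 ^ ia (K a b) (lookup v)))))
            (≤-reflexive (sym (activitySum-permVecs (K a b) 0 2)))

square≤product : {a b c I E X Y : ℕ} → a ≥ 1 → b ≥ 1 → a * c ≤ suc b * I → b * c ≤ suc a * E →
                 2 * I ≤ X → 2 * E ≤ Y → c * c ≤ X * Y
square≤product {a@(suc a′)} {b@(suc b′)} {c} {I} {E} {X} {Y} (s≤s z≤n) (s≤s z≤n) aI bE 2I≤X 2E≤Y =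
  *-cancelˡ-≤ (suc a * suc b) (begin
  (suc a * suc b) * (c * c)                ≤⟨ *-monoˡ-≤ (c * c) (subst (suc a * suc b ≤_) (sym (coefficient a′ b′)) (m≤m+n _ _)) ⟩
  (4 * a * b) * (c * c)                    ≡⟨ regroupˡ a b c ⟩
  (2 * (a * c)) * (2 * (b * c))            ≤⟨ *-mono-≤ (*-monoʳ-≤ 2 aI) (*-monoʳ-≤ 2 bE) ⟩
  (2 * (suc b * I)) * (2 * (suc a * E))    ≡⟨ regroupʳ (suc a) (suc b) I E ⟩
  (suc a * suc b) * ((2 * I) * (2 * E))    ≤⟨ *-monoʳ-≤ (suc a * suc b) (*-mono-≤ 2I≤X 2E≤Y) ⟩
  (suc a * suc b) * (X * Y)                ∎)
  where
  open ≤-Reasoning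
  -- (a + 1)(b + 1) ≤ 4ab, with the slack written out as a polynomial in a - 1, b - 1.
  coefficient : ∀ x y → 4 * suc x * suc y ≡ suc (suc x) * suc (suc y) + (2 * x + 2 * y + 3 * (x * y))
  coefficient = solve-∀
  regroupˡ : ∀ x y z → (4 * x * y) * (z * z) ≡ (2 * (x * z)) * (2 * (y * z))
  regroupˡ = solve-∀
  regroupʳ : ∀ x y z w → (2 * (y * z)) * (2 * (x * w)) ≡ (x * y) * ((2 * z) * (2 * w))
  regroupʳ = solve-∀

/-square≤/-product : (x y z d : ℕ) .{{_ : NonZero d}} → x * x ≤ y * z →
                     ((ℤ.+ x) ℚ./ d) ℚ.* ((ℤ.+ x) ℚ./ d) ℚ.≤ ((ℤ.+ y) ℚ./ d) ℚ.* ((ℤ.+ z) ℚ./ d)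
/-square≤/-product x y z (suc k) xx≤yz = ℚ.toℚᵘ-cancel-≤
  (ℚᵘ.≤-respʳ-≃ (ℚᵘ.≃-sym (toℚᵘ-/* y z)) (ℚᵘ.≤-respˡ-≃ (ℚᵘ.≃-sym (toℚᵘ-/* x x))
    (ℚᵘ.*≤* (subst₂ (λ p q → p ℤ.* ℤ.+ (suc k * suc k) ℤ.≤ q ℤ.* ℤ.+ (suc k * suc k)) (ℤ.pos-* x x) (ℤ.pos-* y z)
      (ℤ.*-monoʳ-≤-nonNeg (ℤ.+ (suc k * suc k)) (ℤ.+≤+ xx≤yz))))))
  where
  toℚᵘ-/* : ∀ p q → ℚ.toℚᵘ (((ℤ.+ p) ℚ./ suc k) ℚ.* ((ℤ.+ q) ℚ./ suc k)) ℚᵘ.≃ ℚᵘ.mkℚᵘ (ℤ.+ p) k ℚᵘ.* ℚᵘ.mkℚᵘ (ℤ.+ q) k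
  toℚᵘ-/* p q = ℚᵘ.≃-trans (ℚ.toℚᵘ-homo-* ((ℤ.+ p) ℚ./ suc k) ((ℤ.+ q) ℚ./ suc k))
    (ℚᵘ.*-cong (ℚ.toℚᵘ-fromℚᵘ (ℚᵘ.mkℚᵘ (ℤ.+ p) k)) (ℚ.toℚᵘ-fromℚᵘ (ℚᵘ.mkℚᵘ (ℤ.+ q) k)))

mainTheorem8 : (a b : ℕ) → a ≥ 1 → b ≥ 1 →
    Ttilde (K a b) 1 1 ℚ.* Ttilde (K a b) 1 1 ℚ.≤ Ttilde (K a b) 2 0 ℚ.* Ttilde (K a b) 0 2
mainTheorem8 a b a≥1 b≥1 =
  /-square≤/-product (activitySum H 1 1) (activitySum H 2 0) (activitySum H 0 2) ((a + b) !) {{(a + b) !≢0}}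
    (subst (λ c → c * c ≤ activitySum H 2 0 * activitySum H 0 2) (sym (activitySum-1-1 H))
      (square≤product a≥1 b≥1 (sum-ia≥ H) (sum-ea≥ H) (2*sum-ia≤activitySum-2-0 a b) (2*sum-ea≤activitySum-0-2 a b)))
  where
  H : BipGraph
  H = K a b
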